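{- Let $P$ be a lattice polytope cut out by the root system $A_n$. Then $P$ is diagonally split for all integers $q \geq 2$.
   Context: For a root system $\Phi$ with root lattice $N$ (generated by the roots), let $M = \mathrm{Hom}(N,\mathbb{Z})$ and $M_{\mathbb{R}} = M \otimes \mathbb{R}$. A polytope $P\subset M_{\mathbb{R}}$ is cut out by $\Phi$ if each facet normal is spanned by a root; it is a lattice polytope if its vertices lie in $M$. For a lattice polytope $P$ with primitive inward facet normals $v_1,\dots,v_s \in N$, the diagonal splitting polytope is $\mathbb{F}_P = \{u \in M_{\mathbb{R}} : -1 \le \langle u, v_i\rangle \le 1 \text{ for } 1 \le i \le s\}$. For an integer $q \ge 2$, $P$ is diagonally split for $q$ if the interior of $\mathbb{F}_P$ contains representatives of every equivalence class in $\frac{1}{q}M/M$. -}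

module Defs where

open import Data.Nat using (ℕ; zero; suc)
open import Data.Integer using (ℤ; +_; -_; _+_; _*_; _<_; _≤_)
open import Data.Fin using (Fin; zero; suc)
open import Data.Product using (Σ; ∃; _×_; _,_)
open import Relation.Binary.PropositionalEquality using (_≡_; _≢_)

∑ : ∀ {k : ℕ} → (Fin k → ℤ) → ℤ
∑ {zero}  f = + 0
∑ {suc k} f = f zero + ∑ (λ i → f (suc i))

-- The root system A_n, realised in the standard way inside ℤ^{n+1}.
--
-- Root lattice N = { v ∈ ℤ^{n+1} : Σ v_c = 0 } (spanned by e_i - e_j).
-- M = Hom(N, ℤ) ≅ ℤ^{n+1} / ℤ·(1,…,1); an element of M is represented
-- by a vector x : Fin (suc n) → ℤ, and the pairing ⟨x , v⟩ = Σ x_c v_c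
-- is well defined for v ∈ N.  Everything below only uses pairings with
-- elements of N, so it is independent of the chosen representatives.

Vec' : ℕ → Set
Vec' n = Fin (suc n) → ℤ

⟨_,_⟩ : ∀ {n} → Vec' n → Vec' n → ℤ
⟨ x , v ⟩ = ∑ (λ c → x c * v c)

InN : ∀ {n} → Vec' n → Set
InN v = ∑ v ≡ + 0

IsRoot : ∀ {n} → Vec' n → Set
IsRoot {n} v = Σ (Fin (suc n)) λ i → Σ (Fin (suc n)) λ j →
  (i ≢ j) × (v i ≡ + 1) × (v j ≡ - (+ 1)) ×
  (∀ c → c ≢ i → c ≢ j → v c ≡ + 0)

Primitive : ∀ {n} → Vec' n → Set
Primitive {n} v = InN v × (∀ (d : ℕ) (w : Vec' n) → (∀ c → v c ≡ + d * w c) → d ≡ 1)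

-- v is spanned by a root: v ∈ ℝ·r for some root r (for integer vectors
-- this is the same as v ∈ ℚ·r, i.e. b·v = a·r with b ≠ 0)
SpannedByRoot : ∀ {n} → Vec' n → Set
SpannedByRoot {n} v = Σ (Vec' n) λ r → IsRoot r × Σ ℤ λ a → Σ ℤ λ b →
  (b ≢ + 0) × (∀ c → b * v c ≡ a * r c)

-- Points y_0,…,y_{k-1} of M are affinely independent in M_ℝ:
-- the only (integer, equivalently real) affine relation is trivial.
-- Σ λ_t y_t = 0 in M_ℝ = ℝ^{n+1}/ℝ·(1,…,1) means all coordinates equal.
AffIndep : ∀ {n k} → (Fin k → Vec' n) → Set
AffIndep {n} {k} y = ∀ (λ' : Fin k → ℤ) → ∑ λ' ≡ + 0 →
  (∀ c c' → ∑ (λ t → λ' t * y t c) ≡ ∑ (λ t → λ' t * y t c')) →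
  ∀ t → λ' t ≡ + 0

-- Lattice polytopes P = conv(V_0,…,V_{m-1}) with V_i ∈ M.

FullDim : ∀ {n m} → (Fin m → Vec' n) → Set
FullDim {n} {m} V = Σ (Fin (suc n) → Fin m) λ ι → AffIndep (λ t → V (ι t))

-- v is a primitive inward facet normal of P = conv V: v is primitive in N
-- and the face of P on which ⟨·,v⟩ is minimal has dimension n-1
-- (contains n affinely independent vertices).
IsFacetNormal : ∀ {n m} → (Fin m → Vec' n) → Vec' n → Set
IsFacetNormal {n} {m} V v = Primitive v × Σ (Fin n → Fin m) λ ι →
  (∀ t (i : Fin m) → ⟨ V (ι t) , v ⟩ ≤ ⟨ V i , v ⟩) × AffIndep (λ t → V (ι t))

CutOutByA : ∀ {n m} → (Fin m → Vec' n) → Set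
CutOutByA V = ∀ v → IsFacetNormal V v → SpannedByRoot v

-- The point u = y / q of M_ℝ (y ∈ M) lies in the interior of
-- F_P = { u : -1 ≤ ⟨u,v⟩ ≤ 1 for all facet normals v }, i.e.
-- -1 < ⟨u,v⟩ < 1 for all facet normals v (multiplied through by q).
InInteriorFP : ∀ {n m} → (Fin m → Vec' n) → (q : ℕ) → Vec' n → Set
InInteriorFP V q y = ∀ v → IsFacetNormal V v →
  (- (+ q) < ⟨ y , v ⟩) × (⟨ y , v ⟩ < + q)

-- P is diagonally split for q: every class [w/q] of (1/q)M / M (w ∈ M)
-- has a representative u = w/q + k (k ∈ M) in the interior of F_P.
DiagonallySplit : ∀ {n m} → (Fin m → Vec' n) → ℕ → Set
DiagonallySplit {n} V q = ∀ (w : Vec' n) → Σ (Vec' n) λ k →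
  InInteriorFP V q (λ c → w c + (+ q) * k c)

module Submission where

-- Realise A_n in ℤ^{n+1}; the roots are the vectors e_i - e_j.
-- (1) A primitive lattice vector spanned by a root is itself a root: it is
--     a rational multiple of e_i - e_j, hence an integer multiple a·(e_i - e_j),
--     and primitivity forces a = ±1; since -(e_i - e_j) = e_j - e_i is again
--     a root, every facet normal of a polytope cut out by A_n is a root.
-- (2) Pairing a point y with the root e_i - e_j gives y_i - y_j.
-- (3) Given a class [w/q] ∈ (1/q)M/M, shift w coordinatewise by multiples of
--     q to its residues y_c = w_c mod q ∈ [0, q).  Then for every facet normal
--     e_i - e_j we get |⟨y, v⟩| = |y_i - y_j| < q, i.e. y/q lies in the
--     interior of F_P.
-- The file first proves finite-sum bookkeeping, then (1), (2) and the
-- residue bound (3), and derives the proposition at the end.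

open import Defs
open import Data.Nat as ℕ using (ℕ; _≤_; NonZero)
open import Data.Fin using (Fin; zero; suc)
open import Data.Fin.Properties using (suc-injective)
open import Data.Integer using (ℤ; +_; -_; _+_; _*_; _-_; _<_; +[1+_]; -[1+_]; _%ℕ_; _/ℕ_; +<+; ≢-nonZero)
open import Data.Integer.Properties
open import Data.Integer.DivMod using (n%ℕd<d; a≡a%ℕn+[a/ℕn]*n)
open import Data.Integer.Solver using (module +-*-Solver)
open import Data.Product using (_×_; _,_; proj₁)
open import Data.Sum using (_⊎_; inj₁; inj₂)
open import Data.Empty using (⊥-elim)
open import Relation.Binary.PropositionalEquality

open +-*-Solver using (solve; _:+_; _:*_; _:-_; :-_; _:=_; con)

∑-vanishing : ∀ {k} (f : Fin k → ℤ) → (∀ c → f c ≡ + 0) → ∑ f ≡ + 0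
∑-vanishing {ℕ.zero}  f f≡0 = refl
∑-vanishing {ℕ.suc k} f f≡0
  rewrite f≡0 zero | ∑-vanishing (λ c → f (suc c)) (λ c → f≡0 (suc c)) = refl

∑-support₁ : ∀ {k} (f : Fin k → ℤ) i → (∀ c → c ≢ i → f c ≡ + 0) → ∑ f ≡ f i
∑-support₁ {ℕ.suc k} f zero f≡0
  rewrite ∑-vanishing (λ c → f (suc c)) (λ c → f≡0 (suc c) (λ ())) = +-identityʳ (f zero)
∑-support₁ {ℕ.suc k} f (suc i) f≡0
  rewrite f≡0 zero (λ ())
        | ∑-support₁ (λ c → f (suc c)) i (λ c c≢i → f≡0 (suc c) (λ e → c≢i (suc-injective e)))
  = +-identityˡ (f (suc i))

∑-support₂ : ∀ {k} (f : Fin k → ℤ) i j → i ≢ j →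
  (∀ c → c ≢ i → c ≢ j → f c ≡ + 0) → ∑ f ≡ f i + f j
∑-support₂ f zero zero i≢j _ = ⊥-elim (i≢j refl)
∑-support₂ f zero (suc j) _ f≡0
  rewrite ∑-support₁ (λ c → f (suc c)) j (λ c c≢j → f≡0 (suc c) (λ ()) (λ e → c≢j (suc-injective e)))
  = refl
∑-support₂ f (suc i) zero _ f≡0
  rewrite ∑-support₁ (λ c → f (suc c)) i (λ c c≢i → f≡0 (suc c) (λ e → c≢i (suc-injective e)) (λ ()))
  = +-comm (f zero) (f (suc i))
∑-support₂ f (suc i) (suc j) i≢j f≡0
  rewrite f≡0 zero (λ ()) (λ ())
        | ∑-support₂ (λ c → f (suc c)) i j (λ e → i≢j (cong suc e))
            (λ c c≢i c≢j → f≡0 (suc c) (λ e → c≢i (suc-injective e)) (λ e → c≢j (suc-injective e)))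
  = +-identityˡ _

root-cong : ∀ {n} {r v : Vec' n} → IsRoot r → (∀ c → v c ≡ r c) → IsRoot v
root-cong (i , j , i≢j , rᵢ , rⱼ , r₀) v≡r =
  i , j , i≢j , trans (v≡r i) rᵢ , trans (v≡r j) rⱼ , λ c c≢i c≢j → trans (v≡r c) (r₀ c c≢i c≢j)

root-neg : ∀ {n} {r v : Vec' n} → IsRoot r → (∀ c → v c ≡ - r c) → IsRoot v
root-neg (i , j , i≢j , rᵢ , rⱼ , r₀) v≡-r =
  j , i , (λ e → i≢j (sym e)) , trans (v≡-r j) (cong -_ rⱼ) , trans (v≡-r i) (cong -_ rᵢ) ,
  λ c c≢j c≢i → trans (v≡-r c) (cong -_ (r₀ c c≢i c≢j))

-- If b·v = a·r with b ≠ 0 and r i = 1, then v is the integer multiple (v i)·r: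
-- a rational multiple of a vector with a unit coordinate is an integer multiple.
spanned⇒multiple : ∀ {n} {v r : Vec' n} (i : Fin (ℕ.suc n)) → r i ≡ + 1 →
  (a b : ℤ) → b ≢ + 0 → (∀ c → b * v c ≡ a * r c) → ∀ c → v c ≡ v i * r c
spanned⇒multiple {v = v} {r} i rᵢ a b b≢0 bv≡ar c =
  *-cancelˡ-≡ b (v c) (v i * r c) {{≢-nonZero b≢0}} (begin
    b * v c         ≡⟨ bv≡ar c ⟩
    a * r c         ≡⟨ cong (_* r c) a≡bvᵢ ⟩
    b * v i * r c   ≡⟨ *-assoc b (v i) (r c) ⟩
    b * (v i * r c) ∎)
  where
  open ≡-Reasoning
  a≡bvᵢ : a ≡ b * v i
  a≡bvᵢ = sym (trans (bv≡ar i) (trans (cong (a *_) rᵢ) (*-identityʳ a)))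

negative-multiple : ∀ k x → -[1+ k ] * x ≡ + ℕ.suc k * - x
negative-multiple k x = trans (sym (neg-distribˡ-* (+ ℕ.suc k) x)) (neg-distribʳ-* (+ ℕ.suc k) x)

primitive-multiple : ∀ {n} {v w : Vec' n} (a : ℤ) → Primitive v →
  (∀ c → v c ≡ a * w c) → (a ≡ + 1) ⊎ (a ≡ - (+ 1))
primitive-multiple {w = w} (+ 0) (_ , prim) v≡aw with prim 0 w v≡aw
... | ()
primitive-multiple +[1+ k ] (_ , prim) v≡aw with prim (ℕ.suc k) _ v≡aw
... | refl = inj₁ refl
primitive-multiple {w = w} -[1+ k ] (_ , prim) v≡aw
  with prim (ℕ.suc k) (λ c → - w c) (λ c → trans (v≡aw c) (negative-multiple k (w c)))
... | refl = inj₂ refl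

unit-multiple⇒root : ∀ {n} {v r : Vec' n} {a : ℤ} → IsRoot r →
  (∀ c → v c ≡ a * r c) → (a ≡ + 1) ⊎ (a ≡ - (+ 1)) → IsRoot v
unit-multiple⇒root {r = r} root v≡ar (inj₁ refl) = root-cong root (λ c → trans (v≡ar c) (*-identityˡ (r c)))
unit-multiple⇒root {r = r} root v≡ar (inj₂ refl) = root-neg root (λ c → trans (v≡ar c) (-1*i≡-i (r c)))

primitive-spanned⇒root : ∀ {n} {v : Vec' n} → Primitive v → SpannedByRoot v → IsRoot v
primitive-spanned⇒root {v = v} prim (r , root@(i , _ , _ , rᵢ , _) , a , b , b≢0 , bv≡ar) =
  unit-multiple⇒root root v≡vᵢr (primitive-multiple (v i) prim v≡vᵢr)
  where
  v≡vᵢr : ∀ c → v c ≡ v i * r c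
  v≡vᵢr = spanned⇒multiple i rᵢ a b b≢0 bv≡ar

facetNormal⇒root : ∀ {n m} (V : Fin m → Vec' n) → CutOutByA V →
  ∀ v → IsFacetNormal V v → IsRoot v
facetNormal⇒root V cut v normal = primitive-spanned⇒root (proj₁ normal) (cut v normal)

pairing-root : ∀ {n} (y : Vec' n) {v : Vec' n} → (root : IsRoot v) →
  let (i , j , _) = root in ⟨ y , v ⟩ ≡ y i - y j
pairing-root y {v} (i , j , i≢j , vᵢ , vⱼ , v₀) = begin
  ∑ (λ c → y c * v c)     ≡⟨ ∑-support₂ _ i j i≢j (λ c c≢i c≢j → trans (cong (y c *_) (v₀ c c≢i c≢j)) (*-zeroʳ (y c))) ⟩
  y i * v i + y j * v j   ≡⟨ cong₂ (λ s t → y i * s + y j * t) vᵢ vⱼ ⟩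
  y i * + 1 + y j * - + 1 ≡⟨ solve 2 (λ a b → a :* con (+ 1) :+ b :* con (- + 1) := a :- b) refl (y i) (y j) ⟩
  y i - y j               ∎
  where open ≡-Reasoning

shift-to-residue : ∀ x q .{{_ : NonZero q}} → x + + q * - (x /ℕ q) ≡ + (x %ℕ q)
shift-to-residue x q = begin
  x + + q * - (x /ℕ q)                           ≡⟨ cong (λ z → z + + q * - (x /ℕ q)) (a≡a%ℕn+[a/ℕn]*n x q) ⟩
  + (x %ℕ q) + (x /ℕ q) * + q + + q * - (x /ℕ q) ≡⟨ solve 3 (λ r d q → r :+ d :* q :+ q :* (:- d) := r) refl (+ (x %ℕ q)) (x /ℕ q) (+ q) ⟩
  + (x %ℕ q)                                     ∎
  where open ≡-Reasoning

residue-difference : ∀ {a b q} → a ℕ.< q → b ℕ.< q → (- (+ q) < + a - + b) × (+ a - + b < + q)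
residue-difference {a} {b} {q} a<q b<q rewrite m-n≡m⊖n a b =
  subst (- (+ q) <_) (sym (⊖-swap a b)) (neg-mono-< (≤-<-trans (m⊖n≤m b a) (+<+ b<q))) ,
  ≤-<-trans (m⊖n≤m a b) (+<+ a<q)

-- Every polytope cut out by A_n is diagonally split for every q ≥ 1:
-- the representative of [w/q] is the vector of residues w_c mod q.
cutOutByA⇒diagonallySplit : ∀ {n m} (V : Fin m → Vec' n) → CutOutByA V →
  ∀ q .{{_ : NonZero q}} → DiagonallySplit V q
cutOutByA⇒diagonallySplit {n} V cut q w = (λ c → - (w c /ℕ q)) , interior
  where
  y : Vec' n
  y c = w c + + q * - (w c /ℕ q)
  -- For a root v = e_i - e_j the pairing is a difference of residues.
  root-bound : ∀ {v} → IsRoot v → (- (+ q) < ⟨ y , v ⟩) × (⟨ y , v ⟩ < + q)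
  root-bound root@(i , j , _) =
    subst (λ z → (- (+ q) < z) × (z < + q))
      (sym (trans (pairing-root y root) (cong₂ _-_ (shift-to-residue (w i) q) (shift-to-residue (w j) q))))
      (residue-difference (n%ℕd<d (w i) q) (n%ℕd<d (w j) q))
  interior : InInteriorFP V q y
  interior v normal = root-bound (facetNormal⇒root V cut v normal)

-- Proposition 3.1: the hypothesis q ≥ 2 provides q ≠ 0, which is all the
-- general statement needs.
proposition3p1 : (n : ℕ) → 1 ≤ n → (m : ℕ) → (V : Fin m → Vec' n) →
    FullDim V → CutOutByA V → (q : ℕ) → 2 ≤ q → DiagonallySplit V q
proposition3p1 n _ m V _ cut (ℕ.suc q') _ = cutOutByA⇒diagonallySplit V cut (ℕ.suc q')
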